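{- Let $S$ and $T$ be association schemes on finite sets $X$ and $Y$, let $S'$ and $T'$ be normal closed subsets of $S$ and $T$ respectively, and let $\phi$ be an admissible morphism from $S$ to $T$ with $\phi(S')\subseteq T'$. Then there is a unique morphism $\bar\phi$ from $S/\!/S'$ to $T/\!/T'$ with $\bar\phi\circ\pi_{S'}=\pi_{T'}\circ\phi$, and $\bar\phi$ is admissible.
   Context: An association scheme on a finite set $X$ is a partition $S$ of $X\times X$ into nonempty subsets such that $1_X=\{(x,x)\}\in S$; $s^*=\{(x,y):(y,x)\in s\}\in S$; and for $p,q,r\in S$ there is $a_{pq}^r\ge0$ with $|\{y:(x,y)\in p,(y,z)\in q\}|=a_{pq}^r$ whenever $(x,z)\in r$. Complex product: $PQ=\{r:a_{pq}^r>0\text{ for some }p\in P,q\in Q\}$. A nonempty $K\subseteq S$ is closed if $KK=K$ and normal if $pK=Kp$ for all $p\in S$. $xK=\{y:(x,y)\in k\text{ for some }k\in K\}$; $X/K$ is the set of these; $s^K=\{(xK,yK):(x',y')\in s\text{ for some }x'\in xK,y'\in yK\}$; $S/\!/K=\{s^K:s\in S\}$ is a scheme on $X/K$; $\pi_K(x)=xK$, $\pi_K(s)=s^K$. A morphism from $S$ on $X$ to $T$ on $Y$ is a function $\phi:X\cup S\to Y\cup T$ with $\phi(X)\subseteq Y$, $\phi(S)\subseteq T$, $(\phi(x_1),\phi(x_2))\in\phi(s)$ whenever $(x_1,x_2)\in s$; it is admissible if whenever $(\phi(x),y)\in\phi(s)$ there is $x'\in X$ with $\phi(x')=y$ and $(x,x')\in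 s$. -}

module Defs where

open import Data.Nat using (ℕ)
open import Data.Bool using (Bool; true; false; _∧_)
open import Data.Bool.Properties using () renaming (_≟_ to _≟ᴮ_)
open import Data.Fin using (Fin)
open import Data.Fin.Properties using (any?) renaming (_≟_ to _≟ᶠ_)
open import Data.Fin.Subset using (Subset; _∈_; ∣_∣; Nonempty)
open import Data.Vec using (Vec; lookup; tabulate)
open import Data.Vec.Properties using (≡-dec)
open import Data.Product using (Σ; ∃; ∃₂; _×_; _,_)
open import Relation.Nullary using (Dec; yes; no)
open import Relation.Nullary.Decidable using (⌊_⌋; True; fromWitness; _×-dec_)
open import Relation.Binary.PropositionalEquality using (_≡_; refl)
open import Function using (_⇔_)

-- The partition S of X × X is given by labelling its m classes by Fin m:
-- rel x y is the (label of the) unique class s ∈ S with (x , y) ∈ s.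
-- So "(x , y) ∈ s" is  rel x y ≡ s.

record Scheme (n m : ℕ) : Set where
  field
    rel : Fin n → Fin n → Fin m
    nonempty : ∀ (s : Fin m) → ∃₂ λ x y → rel x y ≡ s
    identity : ∃ λ (o : Fin m) → ∀ x y → (rel x y ≡ o) ⇔ (x ≡ y)
    converse : ∀ (s : Fin m) → ∃ λ (t : Fin m) → ∀ x y → (rel x y ≡ t) ⇔ (rel y x ≡ s)
    intersection : ∀ (p q r : Fin m) → ∃ λ (a : ℕ) → ∀ x z → rel x z ≡ r →
      ∣ tabulate (λ y → ⌊ rel x y ≟ᶠ p ⌋ ∧ ⌊ rel y z ≟ᶠ q ⌋) ∣ ≡ a

open Scheme public

module _ {n m : ℕ} (S : Scheme n m) where

  -- r ∈ PQ, i.e. a_pq^r > 0 for some p ∈ P, q ∈ Q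
  -- (a_pq^r > 0 iff some x,y,z have (x,y) ∈ p, (y,z) ∈ q, (x,z) ∈ r).
  InProd : (Fin m → Set) → (Fin m → Set) → Fin m → Set
  InProd P Q r = ∃₂ λ p q → P p × Q q ×
    (Σ (Fin n) λ x → Σ (Fin n) λ y → Σ (Fin n) λ z →
       rel S x y ≡ p × rel S y z ≡ q × rel S x z ≡ r)

  IsClosed : Subset m → Set
  IsClosed K = Nonempty K × (∀ r → InProd (_∈ K) (_∈ K) r ⇔ r ∈ K)

  IsNormal : Subset m → Set
  IsNormal K = Nonempty K ×
    (∀ p r → InProd (_≡ p) (_∈ K) r ⇔ InProd (_∈ K) (_≡ p) r)

  module _ (K : Subset m) where

    coset : Fin n → Subset n
    coset x = tabulate (λ y → lookup K (rel S x y))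

    -- X/K : the subsets of X of the form xK (the second component is a
    -- proof-irrelevant certificate, so points are determined by the subset)
    QPoint : Set
    QPoint = Σ (Subset n) λ A → True (any? (λ x → ≡-dec _≟ᴮ_ A (coset x)))

    -- s^K, a set of pairs of cosets, tabulated on representatives:
    -- entry (x , y) is true iff (xK , yK) ∈ s^K, i.e. iff there are
    -- x' ∈ xK, y' ∈ yK with (x' , y') ∈ s.  (This only depends on xK, yK.)
    quotTable : Fin m → Vec (Subset n) n
    quotTable s = tabulate λ x → tabulate λ y →
      ⌊ any? (λ x' → any? (λ y' →
          (lookup (coset x) x' ≟ᴮ true) ×-dec
          ((lookup (coset y) y' ≟ᴮ true) ×-dec (rel S x' y' ≟ᶠ s)))) ⌋

    QRel : Set
    QRel = Σ (Vec (Subset n) n) λ M →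
      True (any? (λ s → ≡-dec (≡-dec _≟ᴮ_) M (quotTable s)))

    QMem : QRel → QPoint → QPoint → Set
    QMem (M , _) (A , _) (B , _) =
      ∃₂ λ x y → A ≡ coset x × B ≡ coset y × lookup (lookup M x) y ≡ true

    πX : Fin n → QPoint
    πX x = coset x , fromWitness (x , refl)

    πS : Fin m → QRel
    πS s = quotTable s , fromWitness (s , refl)

record Str : Set₁ where
  field
    Pt  : Set
    Rl  : Set
    mem : Rl → Pt → Pt → Set

open Str public

⟦_⟧ : ∀ {n m} → Scheme n m → Str
⟦_⟧ {n} {m} S = record { Pt = Fin n ; Rl = Fin m ; mem = λ s x y → rel S x y ≡ s }

_//_ : ∀ {n m} → Scheme n m → Subset m → Str
S // K = record { Pt = QPoint S K ; Rl = QRel S K ; mem = QMem S K }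

IsMorphism : (A B : Str) → (Pt A → Pt B) → (Rl A → Rl B) → Set
IsMorphism A B f g = ∀ s x₁ x₂ → mem A s x₁ x₂ → mem B (g s) (f x₁) (f x₂)

IsAdmissible : (A B : Str) → (Pt A → Pt B) → (Rl A → Rl B) → Set
IsAdmissible A B f g = ∀ x s y → mem B (g s) (f x) y →
  ∃ λ x' → f x' ≡ y × mem A s x x'

-- For a closed subset K of a scheme S write x ~ y when the colour
-- of (x , y) lies in K.  We first show that ~ is an equivalence relation
-- (transitivity is closedness; symmetry follows from a pigeonhole argument
-- on an orbit, reflexivity from symmetry), so xK = yK iff x ~ y.  Next we
-- describe the relation s^K concretely: (xK , yK) ∈ s^K iff some s-pair is
-- ~-close to (x , y), and this depends only on the colour of (x , y); hence
-- s^K = t^K iff some t-pair is ~-close to an s-pair.  Since φ preserves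
-- colours and ~, it preserves all these descriptions, so the map
-- ψ(xK) = φ(x)T', ψ(s^K) = φ(s)^T' (computed on chosen representatives) is
-- well defined, commutes with the projections, and is a morphism; it is
-- unique because the projections are surjective.  Admissibility of ψ uses
-- admissibility of φ together with normality of T' in the form
-- "a T'-step followed by a p-step can be traded for a p-step followed by a
-- T'-step".
module Submission where

open import Defs
open import Data.Nat using (ℕ; zero; suc; _<_; s≤s)
open import Data.Nat.Properties using (n<1+n; m≤n⇒m<n∨m≡n; m<n⇒n≢0)
open import Data.Bool using (Bool; true; false; T; _∧_)
open import Data.Bool.Properties using (T-≡; T-∧; T-irrelevant) renaming (_≟_ to _≟ᴮ_)
open import Data.Fin using (Fin; toℕ)
open import Data.Fin.Properties using (any?; pigeonhole) renaming (_≟_ to _≟ᶠ_)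
open import Data.Fin.Subset using (Subset; _∈_; ∣_∣; Nonempty)
open import Data.Fin.Subset.Properties using (nonempty?; Empty-unique; ∣⊥∣≡0; x∈p⇒∣p-x∣<∣p∣)
open import Data.Vec using (lookup; tabulate)
open import Data.Vec.Properties using (lookup∘tabulate; tabulate-cong; []=⇒lookup; lookup⇒[]=)
open import Data.Product using (Σ; ∃; ∃₂; _×_; _,_; proj₁; proj₂)
open import Data.Sum using (inj₁; inj₂)
open import Relation.Nullary using (Dec; yes; no; contradiction)
open import Relation.Nullary.Decidable
  using (⌊_⌋; toWitness; fromWitness; _×-dec_; does-⇔; isYes≗does)
open import Relation.Binary.PropositionalEquality
open import Function using (_⇔_; mk⇔; Equivalence)
open import Function.Properties.Equivalence using () renaming (trans to ⇔-trans; sym to ⇔-sym)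

open Equivalence using (to; from)

Σ-T-≡ : ∀ {A : Set} {b : A → Bool} {u v : Σ A (λ a → T (b a))} →
  proj₁ u ≡ proj₁ v → u ≡ v
Σ-T-≡ {u = a , t} {v = .a , t'} refl = cong (a ,_) (T-irrelevant t t')

⌊⌋-⇔ : ∀ {A B : Set} → A ⇔ B → (a? : Dec A) (b? : Dec B) → ⌊ a? ⌋ ≡ ⌊ b? ⌋
⌊⌋-⇔ A⇔B a? b? = trans (isYes≗does a?) (trans (does-⇔ A⇔B a? b?) (sym (isYes≗does b?)))

⌊⌋∧⌊⌋⇔× : ∀ {A B : Set} (a? : Dec A) (b? : Dec B) → ⌊ a? ⌋ ∧ ⌊ b? ⌋ ≡ true ⇔ (A × B)
⌊⌋∧⌊⌋⇔× a? b? = ⇔-trans (⇔-sym T-≡) (⇔-trans (T-∧ {⌊ a? ⌋} {⌊ b? ⌋})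
  (mk⇔ (λ (a , b) → toWitness a , toWitness b) (λ (a , b) → fromWitness a , fromWitness b)))

true⇔true : ∀ {a b : Bool} → a ≡ true ⇔ b ≡ true → a ≡ b
true⇔true {true}          a⇔b = sym (to a⇔b refl)
true⇔true {false} {true}  a⇔b = from a⇔b refl
true⇔true {false} {false} _   = refl

nonempty-by-size : ∀ {n} {p q : Subset n} → ∣ p ∣ ≡ ∣ q ∣ → Nonempty q → Nonempty p
nonempty-by-size {n} {p} {q} same (x , x∈q) with nonempty? p
... | yes p≠∅ = p≠∅
... | no  p=∅ = contradiction ∣q∣≡0 (m<n⇒n≢0 (x∈p⇒∣p-x∣<∣p∣ x∈q))
  where
  ∣q∣≡0 : ∣ q ∣ ≡ 0
  ∣q∣≡0 = trans (sym same) (trans (cong ∣_∣ (Empty-unique p=∅)) (∣⊥∣≡0 n))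

-- If R is transitive and every point is R-related to its image under f, then
-- some point is R-related back from its image: the orbit of any point under f
-- revisits a point (pigeonhole), and following the cycle closes the loop.
module Orbit {n} (R : Fin n → Fin n → Set)
    (R-trans : ∀ {x y z} → R x y → R y z → R x z)
    (f : Fin n → Fin n) (step : ∀ w → R w (f w)) where

  iter : Fin n → ℕ → Fin n
  iter w zero    = w
  iter w (suc k) = f (iter w k)

  iter-R : ∀ w {i j} → i < j → R (iter w i) (iter w j)
  iter-R w {i} {suc j} (s≤s i≤j) with m≤n⇒m<n∨m≡n i≤j
  ... | inj₁ i<j  = R-trans (iter-R w i<j) (step (iter w j))
  ... | inj₂ refl = step (iter w i)

  closes : ∀ w {i j} → i < j → iter w i ≡ iter w j → R (f (iter w i)) (iter w i)
  closes w {i} i<j same with m≤n⇒m<n∨m≡n i<j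
  ... | inj₁ 1+i<j = subst (R (f (iter w i))) (sym same) (iter-R w 1+i<j)
  ... | inj₂ refl  = subst₂ R same refl (subst (R (iter w i)) (sym same) (step (iter w i)))

  cycle : Fin n → ∃ λ u → R (f u) u
  cycle w with pigeonhole (n<1+n n) (λ k → iter w (toℕ k))
  ... | i , _ , i<j , same = iter w (toℕ i) , closes w i<j same

module SchemeFacts {n m} (S : Scheme n m) where

  -- Intersection numbers at work: a triangle x₀ → y₀ → z₀ whose base has the
  -- colour of (x , z) can be rebuilt over (x , z).
  lift-triangle : ∀ {x z} x₀ y₀ z₀ → rel S x₀ z₀ ≡ rel S x z →
    ∃ λ y → rel S x y ≡ rel S x₀ y₀ × rel S y z ≡ rel S y₀ z₀
  lift-triangle {x} {z} x₀ y₀ z₀ base = proj₁ found , to ∈-triangles (proj₂ found)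
    where
    is-triangle : Fin n → Fin n → Fin n → Bool
    is-triangle u v y = ⌊ rel S u y ≟ᶠ rel S x₀ y₀ ⌋ ∧ ⌊ rel S y v ≟ᶠ rel S y₀ z₀ ⌋

    triangles : Fin n → Fin n → Subset n
    triangles u v = tabulate (is-triangle u v)

    ∈-triangles : ∀ {u v y} →
      y ∈ triangles u v ⇔ (rel S u y ≡ rel S x₀ y₀ × rel S y v ≡ rel S y₀ z₀)
    ∈-triangles {u} {v} {y} = mk⇔
      (λ y∈ → to both (trans (sym (lookup∘tabulate (is-triangle u v) y)) ([]=⇒lookup y∈)))
      (λ es → lookup⇒[]= y _ (trans (lookup∘tabulate (is-triangle u v) y) (from both es)))
      where both = ⌊⌋∧⌊⌋⇔× (rel S u y ≟ᶠ rel S x₀ y₀) (rel S y v ≟ᶠ rel S y₀ z₀)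

    count : ∀ u v → rel S u v ≡ rel S x₀ z₀ →
      ∣ triangles u v ∣ ≡ proj₁ (intersection S (rel S x₀ y₀) (rel S y₀ z₀) (rel S x₀ z₀))
    count = proj₂ (intersection S (rel S x₀ y₀) (rel S y₀ z₀) (rel S x₀ z₀))

    found : Nonempty (triangles x z)
    found = nonempty-by-size (trans (count x z (sym base)) (sym (count x₀ z₀ refl)))
                             (y₀ , from ∈-triangles (refl , refl))

  diagonal : ∀ x y → rel S x x ≡ rel S y y
  diagonal x y with identity S
  ... | o , isO = trans (from (isO x x) refl) (sym (from (isO y y) refl))

  -- Every point w starts a step w → w' of the colour of x → y, and the way
  -- back w' → w has the colour of y → x (lift the triangle x → y → x).
  step-from : ∀ x y w → ∃ λ w' → rel S w w' ≡ rel S x y × rel S w' w ≡ rel S y x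
  step-from x y w = lift-triangle x y x (diagonal x w)

module Quotient {n m} (S : Scheme n m) (K : Subset m) where
  open SchemeFacts S

  infix 4 _~_
  _~_ : Fin n → Fin n → Set
  x ~ y = rel S x y ∈ K

  coset⇔ : ∀ {x y} → lookup (coset S K x) y ≡ true ⇔ x ~ y
  coset⇔ {x} {y} = mk⇔
    (λ e → lookup⇒[]= _ K (trans (sym (lookup∘tabulate (λ z → lookup K (rel S x z)) y)) e))
    (λ x~y → trans (lookup∘tabulate (λ z → lookup K (rel S x z)) y) ([]=⇒lookup x~y))

  -- (xK , yK) ∈ s^K, phrased with ~: some s-pair is ~-close to (x , y).
  InTable : Fin m → Fin n → Fin n → Set
  InTable s x y = ∃₂ λ x' y' → x ~ x' × y ~ y' × rel S x' y' ≡ s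

  Entry : Fin m → Fin n → Fin n → Set
  Entry s x y = ∃ λ x' → ∃ λ y' → lookup (coset S K x) x' ≡ true ×
    (lookup (coset S K y) y' ≡ true × rel S x' y' ≡ s)

  entry? : ∀ s x y → Dec (Entry s x y)
  entry? s x y = any? λ x' → any? λ y' →
    (lookup (coset S K x) x' ≟ᴮ true) ×-dec
    ((lookup (coset S K y) y' ≟ᴮ true) ×-dec (rel S x' y' ≟ᶠ s))

  Entry⇔InTable : ∀ {s x y} → Entry s x y ⇔ InTable s x y
  Entry⇔InTable = mk⇔
    (λ (x' , y' , a , b , c) → x' , y' , to coset⇔ a , to coset⇔ b , c)
    (λ (x' , y' , a , b , c) → x' , y' , from coset⇔ a , from coset⇔ b , c)

  table-lookup : ∀ s x y → lookup (lookup (quotTable S K s) x) y ≡ ⌊ entry? s x y ⌋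
  table-lookup s x y = trans (cong (λ row → lookup row y) (lookup∘tabulate _ x))
                             (lookup∘tabulate _ y)

  table⇔ : ∀ {s x y} → lookup (lookup (quotTable S K s) x) y ≡ true ⇔ InTable s x y
  table⇔ {s} {x} {y} = mk⇔
    (λ e → to Entry⇔InTable (toWitness (from T-≡ (trans (sym (table-lookup s x y)) e))))
    (λ i → trans (table-lookup s x y) (to T-≡ (fromWitness (from Entry⇔InTable i))))

  table-≡ : ∀ {s t} → (∀ x y → InTable s x y ⇔ InTable t x y) →
    quotTable S K s ≡ quotTable S K t
  table-≡ {s} {t} same = tabulate-cong λ x → tabulate-cong λ y →
    ⌊⌋-⇔ (⇔-trans Entry⇔InTable (⇔-trans (same x y) (⇔-sym Entry⇔InTable)))
         (entry? s x y) (entry? t x y)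

  InTable⇒QMem : ∀ {s x y} → InTable s x y → QMem S K (πS S K s) (πX S K x) (πX S K y)
  InTable⇒QMem {x = x} {y} i = x , y , refl , refl , from table⇔ i

  rep : QPoint S K → Fin n
  rep (_ , w) = proj₁ (toWitness w)

  rep-coset : ∀ A → proj₁ A ≡ coset S K (rep A)
  rep-coset (_ , w) = proj₂ (toWitness w)

  πX-rep : ∀ A → πX S K (rep A) ≡ A
  πX-rep A = Σ-T-≡ (sym (rep-coset A))

  repS : QRel S K → Fin m
  repS (_ , w) = proj₁ (toWitness w)

  repS-table : ∀ M → proj₁ M ≡ quotTable S K (repS M)
  repS-table (_ , w) = proj₂ (toWitness w)

  πS-rep : ∀ M → πS S K (repS M) ≡ M
  πS-rep M = Σ-T-≡ (sym (repS-table M))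

  -- Normality Kp = pK, pointwise: a K-step followed by a p-step can be
  -- traded for a p-step followed by a K-step with the same end points.
  normal-swap : IsNormal S K → ∀ {a b c} → a ~ b →
    ∃ λ y → rel S a y ≡ rel S b c × y ~ c
  normal-swap (_ , normal) {a} {b} {c} a~b
    with from (normal (rel S b c) (rel S a c))
              (rel S a b , rel S b c , a~b , refl , a , b , c , refl , refl , refl)
  ... | _ , _ , refl , q∈K , x₁ , y₁ , z₁ , p-step , refl , base
    with lift-triangle x₁ y₁ z₁ base
  ... | y , e₁ , e₂ = y , trans e₁ p-step , subst (_∈ K) (sym e₂) q∈K

  module Closed (closed : IsClosed S K) where

    -- Transitivity is KK ⊆ K.
    ~-trans : ∀ {x y z} → x ~ y → y ~ z → x ~ z
    ~-trans {x} {y} {z} x~y y~z = to (proj₂ closed (rel S x z))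
      (rel S x y , rel S y z , x~y , y~z , x , y , z , refl , refl , refl)

    -- Follow steps of the colour of x → y from x; the orbit closes a loop
    -- (Orbit.cycle), and the last step of the loop, taken backwards, is a
    -- K-step of the colour of y → x.
    ~-sym : ∀ {x y} → x ~ y → y ~ x
    ~-sym {x} {y} x~y = subst (_∈ K) (proj₂ (proj₂ (step-from x y u))) next-u~u
      where
      next : Fin n → Fin n
      next w = proj₁ (step-from x y w)
      open Orbit _~_ ~-trans next (λ w → subst (_∈ K) (sym (proj₁ (proj₂ (step-from x y w)))) x~y)
      u = proj₁ (cycle x)
      next-u~u = proj₂ (cycle x)

    -- Some k ∈ K occurs as a step x → y; then x ~ y ~ x.
    ~-refl : ∀ x → x ~ x
    ~-refl x with proj₁ closed
    ... | k , k∈K with nonempty S k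
    ... | a , b , refl with step-from a b x
    ... | y , x→y , _ = ~-trans x~y (~-sym x~y)
      where
      x~y : x ~ y
      x~y = subst (_∈ K) (sym x→y) k∈K

    -- xK = yK gives y ∈ yK = xK.
    coset-≡⇒~ : ∀ {x y} → coset S K x ≡ coset S K y → x ~ y
    coset-≡⇒~ {x} {y} same =
      to coset⇔ (trans (cong (λ A → lookup A y) same) (from coset⇔ (~-refl y)))

    ~⇒πX-≡ : ∀ {x y} → x ~ y → πX S K x ≡ πX S K y
    ~⇒πX-≡ {x} {y} x~y = Σ-T-≡ (tabulate-cong λ z → true⇔true (mk⇔
      (λ e → []=⇒lookup (~-trans (~-sym x~y) (lookup⇒[]= _ K e)))
      (λ e → []=⇒lookup (~-trans x~y (lookup⇒[]= _ K e)))))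

    InTable-resp : ∀ {s x y x₀ y₀} → x₀ ~ x → y₀ ~ y → InTable s x y → InTable s x₀ y₀
    InTable-resp x₀~x y₀~y (x' , y' , x~x' , y~y' , e) =
      x' , y' , ~-trans x₀~x x~x' , ~-trans y₀~y y~y' , e

    -- Membership in s^K depends only on the colour of the pair: lift the
    -- square a → a' → b' → b over (u , v), one triangle at a time.
    InTable-colour : ∀ {s a b u v} → rel S a b ≡ rel S u v → InTable s a b → InTable s u v
    InTable-colour {a = a} {b} colour (a' , b' , a~a' , b~b' , e)
      with lift-triangle a b' b colour
    ... | w , uw , wv with lift-triangle a a' b' (sym uw)
    ... | z , uz , zw =
      z , w , subst (_∈ K) (sym uz) a~a' , ~-sym (subst (_∈ K) (sym wv) (~-sym b~b')) , trans zw e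

    table-≡-from : ∀ {s a b} → InTable s a b → quotTable S K s ≡ quotTable S K (rel S a b)
    table-≡-from {s} {a} {b} ab∈s@(a' , b' , a~a' , b~b' , e) =
      table-≡ λ x y → mk⇔ s⇒t t⇒s
      where
      s⇒t : ∀ {x y} → InTable s x y → InTable (rel S a b) x y
      s⇒t (x' , y' , x~x' , y~y' , e') = InTable-resp x~x' y~y'
        (InTable-colour (trans e (sym e')) (a , b , ~-sym a~a' , ~-sym b~b' , refl))
      t⇒s : ∀ {x y} → InTable (rel S a b) x y → InTable s x y
      t⇒s (x' , y' , x~x' , y~y' , e') = InTable-resp x~x' y~y' (InTable-colour (sym e') ab∈s)

    table-≡⇒InTable : ∀ {s t a b} → quotTable S K s ≡ quotTable S K t → rel S a b ≡ t →
      InTable s a b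
    table-≡⇒InTable {a = a} {b} same e = to table⇔
      (subst (λ M → lookup (lookup M a) b ≡ true) (sym same)
        (from table⇔ (a , b , ~-refl a , ~-refl b , e)))

    QMem⇒InTable : ∀ {M A B s x y} → proj₁ M ≡ quotTable S K s →
      proj₁ A ≡ coset S K x → proj₁ B ≡ coset S K y → QMem S K M A B → InTable s x y
    QMem⇒InTable {_ , _} {_ , _} {_ , _} refl refl refl (x' , y' , ex , ey , entry) =
      InTable-resp (coset-≡⇒~ ex) (coset-≡⇒~ ey) (to table⇔ entry)

module Induced {n m n' m'} {S : Scheme n m} {T : Scheme n' m'} {S' : Subset m} {T' : Subset m'}
    (S'-closed : IsClosed S S') (T'-closed : IsClosed T T')
    (φX : Fin n → Fin n') (φS : Fin m → Fin m')
    (φ-morphism : IsMorphism ⟦ S ⟧ ⟦ T ⟧ φX φS) (φS' : ∀ s → s ∈ S' → φS s ∈ T') where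
  module QS = Quotient S S'
  module QT = Quotient T T'
  module CS = QS.Closed S'-closed
  module CT = QT.Closed T'-closed

  ψX : QPoint S S' → QPoint T T'
  ψX A = πX T T' (φX (QS.rep A))

  ψS : QRel S S' → QRel T T'
  ψS M = πS T T' (φS (QS.repS M))

  map-~ : ∀ {x y} → x QS.~ y → φX x QT.~ φX y
  map-~ {x} {y} x~y = subst (_∈ T') (sym (φ-morphism (rel S x y) x y refl)) (φS' _ x~y)

  map-InTable : ∀ {s x y} → QS.InTable s x y → QT.InTable (φS s) (φX x) (φX y)
  map-InTable (x' , y' , x~x' , y~y' , refl) =
    φX x' , φX y' , map-~ x~x' , map-~ y~y' , φ-morphism _ x' y' refl

  -- The representative chosen for xS' is ~-equivalent to x.
  ψX-π : ∀ x → ψX (πX S S' x) ≡ πX T T' (φX x)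
  ψX-π x = CT.~⇒πX-≡ (map-~ (CS.coset-≡⇒~ (sym (QS.rep-coset (πX S S' x)))))

  -- The representative r of s^S' has s^S' = r^S'; an s-pair (a , b) then
  -- lies in r^S', and its image shows φ(r)^T' = φ(s)^T'.
  ψS-π : ∀ s → ψS (πS S S' s) ≡ πS T T' (φS s)
  ψS-π s with nonempty S s
  ... | a , b , ab∈s = Σ-T-≡ (begin
      quotTable T T' (φS r)                 ≡⟨ CT.table-≡-from (map-InTable ab∈r) ⟩
      quotTable T T' (rel T (φX a) (φX b))  ≡⟨ cong (quotTable T T') (φ-morphism s a b ab∈s) ⟩
      quotTable T T' (φS s)                 ∎)
    where
    open ≡-Reasoning
    r = QS.repS (πS S S' s)
    ab∈r : QS.InTable r a b
    ab∈r = CS.table-≡⇒InTable (sym (QS.repS-table (πS S S' s))) ab∈s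

  ψ-morphism : IsMorphism (S // S') (T // T') ψX ψS
  ψ-morphism M A B AB∈M = QT.InTable⇒QMem {φS (QS.repS M)} {φX (QS.rep A)} {φX (QS.rep B)}
    (map-InTable (CS.QMem⇒InTable {M} {A} {B} {QS.repS M} {QS.rep A} {QS.rep B}
      (QS.repS-table M) (QS.rep-coset A) (QS.rep-coset B) AB∈M))

  -- Given (φ(x)T' , B) ∈ φ(s)^T', normality of T' produces y with
  -- rel (φ x) y = φ s and yT' = B; admissibility of φ lifts y to some x'.
  ψ-admissible : IsNormal T T' → IsAdmissible ⟦ S ⟧ ⟦ T ⟧ φX φS →
    IsAdmissible (S // S') (T // T') ψX ψS
  ψ-admissible T'-normal φ-admissible A M B AB∈ψM =
    preimage (CT.QMem⇒InTable {M = ψS M} {ψX A} {B} refl refl (QT.rep-coset B) AB∈ψM)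
    where
    x = QS.rep A
    s = QS.repS M
    preimage : QT.InTable (φS s) (φX x) (QT.rep B) →
      ∃ λ A' → ψX A' ≡ B × QMem S S' M A A'
    preimage (u , v , φx~u , B~v , uv∈φs) with QT.normal-swap T'-normal φx~u
    ... | y , φx→y , y~v with φ-admissible x s y (trans φx→y uv∈φs)
    ... | x' , refl , xx'∈s =
      πX S S' x' ,
      trans (ψX-π x') (trans (CT.~⇒πX-≡ (CT.~-trans y~v (CT.~-sym B~v))) (QT.πX-rep B)) ,
      subst₂ (λ M A → QMem S S' M A (πX S S' x')) (QS.πS-rep M) (QS.πX-rep A)
        (QS.InTable⇒QMem (x , x' , CS.~-refl x , CS.~-refl x' , xx'∈s))

  -- Uniqueness: the projections are surjective.
  ψ-unique : ∀ (χX : QPoint S S' → QPoint T T') (χS : QRel S S' → QRel T T') →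
    (∀ x → χX (πX S S' x) ≡ πX T T' (φX x)) → (∀ s → χS (πS S S' s) ≡ πS T T' (φS s)) →
    (∀ A → χX A ≡ ψX A) × (∀ M → χS M ≡ ψS M)
  ψ-unique χX χS χX-π χS-π =
    (λ A → trans (cong χX (sym (QS.πX-rep A))) (χX-π (QS.rep A))) ,
    (λ M → trans (cong χS (sym (QS.πS-rep M))) (χS-π (QS.repS M)))

-- The theorem: ψ is the required morphism.
corollary4p6 : ∀ {n m n' m'} (S : Scheme n m) (T : Scheme n' m')
    (S' : Subset m) (T' : Subset m') →
    IsNormal S S' → IsClosed S S' → IsNormal T T' → IsClosed T T' →
    (φX : Fin n → Fin n') (φS : Fin m → Fin m') →
    IsMorphism ⟦ S ⟧ ⟦ T ⟧ φX φS → IsAdmissible ⟦ S ⟧ ⟦ T ⟧ φX φS →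
    (∀ s → s ∈ S' → φS s ∈ T') →
    Σ (QPoint S S' → QPoint T T') λ ψX → Σ (QRel S S' → QRel T T') λ ψS →
      (IsMorphism (S // S') (T // T') ψX ψS
        × (∀ x → ψX (πX S S' x) ≡ πX T T' (φX x))
        × (∀ s → ψS (πS S S' s) ≡ πS T T' (φS s)))
      × IsAdmissible (S // S') (T // T') ψX ψS
      × (∀ (χX : QPoint S S' → QPoint T T') (χS : QRel S S' → QRel T T') →
           IsMorphism (S // S') (T // T') χX χS →
           (∀ x → χX (πX S S' x) ≡ πX T T' (φX x)) →
           (∀ s → χS (πS S S' s) ≡ πS T T' (φS s)) →
           (∀ p → χX p ≡ ψX p) × (∀ r → χS r ≡ ψS r))
corollary4p6 S T S' T' _ S'-closed T'-normal T'-closed φX φS φ-morphism φ-admissible φS' =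
  ψX , ψS , (ψ-morphism , ψX-π , ψS-π) , ψ-admissible T'-normal φ-admissible ,
  λ χX χS _ → ψ-unique χX χS
  where open Induced {S = S} {T} S'-closed T'-closed φX φS φ-morphism φS'
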